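{- Let $V=\{1,\dots,n\}$, $m\ge1$, $0\le\lambda\le1$, $\bar\lambda=1-\lambda$, and let $f_1,\dots,f_m:2^V\to\mathbb{R}$ be normalized, monotone non-decreasing, submodular functions with Lovász extensions $\tilde f_1,\dots,\tilde f_m$. Let $(x_1^*,\dots,x_m^*)$ be an optimal solution of the convex program $$\min_{x_1,\dots,x_m\in[0,1]^n}\ \max_i \bar\lambda\tilde f_i(x_i)+\frac{\lambda}{m}\sum_{j=1}^m\tilde f_j(x_j)\quad\text{s.t.}\quad\sum_{i=1}^m x_i(j)\ge1\ \text{ for } j=1,\dots,n,$$ and let $\hat\pi$ be obtained by assigning each $j\in V$ to one block $\hat i\in\arg\max_i x_i^*(j)$ (ties broken arbitrarily). Then $$\max_i\bar\lambda f_i(A_i^{\hat\pi})+\frac{\lambda}{m}\sum_{j=1}^m f_j(A_j^{\hat\pi})\ \le\ m\min_{\pi\in\Pi}\Big[\max_i\bar\lambda f_i(A_i^{\pi})+\frac{\lambda}{m}\sum_{j=1}^m f_j(A_j^{\pi})\Big].$$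
   Context: $f$ is normalized if $f(\emptyset)=0$, monotone non-decreasing if $f(S)\le f(T)$ for $S\subseteq T$, submodular if $f(S)+f(T)\ge f(S\cup T)+f(S\cap T)$. $\Pi$ is the set of ordered partitions of $V$ into $m$ pairwise disjoint (possibly empty) blocks covering $V$. The Lovász extension of $f$: for $x\in[0,1]^n$, let $\sigma_x$ order the coordinates of $x$ non-increasingly, $S_j=\{\sigma_x(1),\dots,\sigma_x(j)\}$, $S_0=\emptyset$; then $\tilde f(x)=\sum_{j=1}^n x(\sigma_x(j))\,(f(S_j)-f(S_{j-1}))$. -}

module Defs where

open import Data.Nat using (ℕ; zero; suc; NonZero)
open import Data.Fin using (Fin; zero; suc; _≟_)
open import Data.Fin.Subset using (Subset; ⊥; _∪_; _∩_; _⊆_; ⁅_⁆)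
open import Data.List using (List; []; _∷_; foldr; allFin)
open import Data.Vec using (tabulate)
open import Data.Bool using (if_then_else_)
open import Relation.Nullary using (¬_; does)
open import Relation.Binary using (Rel; Decidable; IsTotalOrder)
open import Relation.Binary.PropositionalEquality using (_≡_; _≢_)
open import Algebra.Core using (Op₁; Op₂)
open import Algebra.Structures using (IsCommutativeRing)

-- An ordered field (with propositional equality and decidable order).
-- ℝ (classically) and ℚ are instances; the scalar field of the paper is ℝ.
record OrderedField : Set₁ where
  infixl 7 _*_
  infixl 6 _+_ _-_
  infix 4 _≤_
  field
    Carrier   : Set
    0# 1#     : Carrier
    _+_ _*_   : Op₂ Carrier
    -_        : Op₁ Carrier
    _⁻¹       : Op₁ Carrier
    _≤_       : Rel Carrier _
    isCommutativeRing : IsCommutativeRing _≡_ _+_ _*_ -_ 0# 1#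
    ⁻¹-inverse : ∀ x → x ≢ 0# → x * (x ⁻¹) ≡ 1#
    0≢1        : 0# ≢ 1#
    isTotalOrder : IsTotalOrder _≡_ _≤_
    _≤?_       : Decidable _≤_
    +-monoˡ-≤  : ∀ {x y} z → x ≤ y → x + z ≤ y + z
    *-nonneg   : ∀ {x y} → 0# ≤ x → 0# ≤ y → 0# ≤ x * y

  _-_ : Op₂ Carrier
  x - y = x + (- y)

module OF (F : OrderedField) where
  open OrderedField F public

  fromℕ : ℕ → Carrier
  fromℕ zero = 0#
  fromℕ (suc k) = 1# + fromℕ k

  max : Carrier → Carrier → Carrier
  max x y = if does (x ≤? y) then y else x

  sumFin : (m : ℕ) → (Fin m → Carrier) → Carrier
  sumFin zero v = 0#
  sumFin (suc m) v = v zero + sumFin m (λ i → v (suc i))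

  maxFin : (m : ℕ) → .{{NonZero m}} → (Fin m → Carrier) → Carrier
  maxFin (suc zero) v = v zero
  maxFin (suc (suc m)) v = max (v zero) (maxFin (suc m) (λ i → v (suc i)))

  SetFun : ℕ → Set
  SetFun n = Subset n → Carrier

  Normalized : ∀ {n} → SetFun n → Set
  Normalized f = f ⊥ ≡ 0#

  Monotone : ∀ {n} → SetFun n → Set
  Monotone f = ∀ S T → S ⊆ T → f S ≤ f T

  Submodular : ∀ {n} → SetFun n → Set
  Submodular f = ∀ S T → f (S ∪ T) + f (S ∩ T) ≤ f S + f T

  -- σ_x : indices of x sorted non-increasingly (insertion sort; ties by index)
  insertDesc : ∀ {n} → (Fin n → Carrier) → Fin n → List (Fin n) → List (Fin n)
  insertDesc x j [] = j ∷ []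
  insertDesc x j (k ∷ ks) =
    if does (x j ≤? x k) then k ∷ insertDesc x j ks else j ∷ k ∷ ks

  sortDesc : ∀ {n} → (Fin n → Carrier) → List (Fin n)
  sortDesc {n} x = foldr (insertDesc x) [] (allFin n)

  -- Σ_j x(σ(j)) (f(S_j) − f(S_{j−1})), S = S_{j−1} accumulated so far
  lovászAux : ∀ {n} → SetFun n → (Fin n → Carrier) → Subset n → List (Fin n) → Carrier
  lovászAux f x S [] = 0#
  lovászAux f x S (j ∷ js) =
    x j * (f (S ∪ ⁅ j ⁆) - f S) + lovászAux f x (S ∪ ⁅ j ⁆) js

  lovász : ∀ {n} → SetFun n → (Fin n → Carrier) → Carrier
  lovász f x = lovászAux f x ⊥ (sortDesc x)

  -- An ordered partition of V = Fin n into m blocks, given by the block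
  -- index of each element; A π i is the i-th block A_i^π.
  Partition : ℕ → ℕ → Set
  Partition n m = Fin n → Fin m

  block : ∀ {n m} → Partition n m → Fin m → Subset n
  block π i = tabulate (λ j → does (π j ≟ i))

  objective : (m : ℕ) → .{{NonZero m}} → Carrier → (Fin m → Carrier) → Carrier
  objective m lam v =
    (1# - lam) * maxFin m v + (lam * (fromℕ m ⁻¹)) * sumFin m v

  InUnitCube : ∀ {n} → (Fin n → Carrier) → Set
  InUnitCube x = ∀ j → (0# ≤ x j) × (x j ≤ 1#)
    where open import Data.Product using (_×_)

  Feasible : ∀ {n m} → (Fin m → Fin n → Carrier) → Set
  Feasible {n} {m} x =
    (∀ i → InUnitCube (x i)) × (∀ j → 1# ≤ sumFin m (λ i → x i j))
    where open import Data.Product using (_×_)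

  Optimal : ∀ {n} (m : ℕ) → .{{NonZero m}} → (Fin m → SetFun n) → Carrier
            → (Fin m → Fin n → Carrier) → Set
  Optimal m f lam xs =
    Feasible xs ×
    (∀ x → Feasible x →
       objective m lam (λ i → lovász (f i) (xs i)) ≤ objective m lam (λ i → lovász (f i) (x i)))
    where open import Data.Product using (_×_)

-- Write c = 1/m. The m coordinates x*_i(j) sum to at least 1, so the largest one is at least c
-- and x*_i ≥ c on the block Â_i; for monotone f the Lovász extension then gives
-- c · f(Â_i) ≤ f̃_i(x*_i). Conversely the indicator vectors of any partition π are feasible, and
-- on an indicator vector the Lovász extension of a monotone submodular f is at most f, so
-- optimality bounds the objective of f̃(x*) by that of f(A^π). The objective is monotone and
-- positively homogeneous, which chains the two bounds with the factor m.
module Submission where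

open import Defs
open import Data.Nat using (ℕ; NonZero)
open import Data.Fin using (Fin)
open import Data.Product using (_×_)

import Data.Nat as ℕ
open import Data.Fin using (zero; suc; _≟_)
open import Data.Fin.Subset using (Subset; _∪_; _∩_; _⊆_; ⁅_⁆; _∈_) renaming (⊥ to ∅)
open import Data.Fin.Subset.Properties
  using (_∈?_; p⊆p∪q; q⊆p∪q; x∈p∪q⁻; x∈p∩q⁺; x∈⁅x⁆; x∈⁅y⁆⇒x≡y; ∪-identityˡ)
open import Data.Product using (_,_; proj₁; proj₂)
open import Data.Sum using (_⊎_; inj₁; inj₂; [_,_])
open import Data.Empty using (⊥-elim)
open import Data.Bool using (if_then_else_)
open import Data.List using (List; []; _∷_; foldr; allFin)
open import Data.List.Relation.Unary.All as All using (All; []; _∷_)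
open import Data.List.Relation.Unary.AllPairs using (AllPairs; []; _∷_)
open import Data.List.Relation.Unary.Any using (here; there)
open import Data.List.Membership.Propositional using () renaming (_∈_ to _∈ₗ_)
open import Data.List.Membership.Propositional.Properties using (∈-allFin)
open import Data.Vec.Properties using ([]=⇒lookup; lookup⇒[]=; lookup∘tabulate)
open import Data.Maybe using (nothing)
open import Function using (_∘_; id)
open import Relation.Nullary using (¬_; does; yes; no)
open import Relation.Nullary.Decidable using (dec-true)
open import Relation.Binary using (IsTotalOrder; Poset)
open import Relation.Binary.PropositionalEquality using (_≡_; _≢_; refl; sym; trans; cong; subst; subst₂)
open import Algebra.Structures using (IsCommutativeRing)
open import Algebra.Bundles using (CommutativeRing)
open import Tactic.RingSolver.Core.AlmostCommutativeRing using (fromCommutativeRing)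

∪-lub : ∀ {n} {p q r : Subset n} → p ⊆ r → q ⊆ r → p ∪ q ⊆ r
∪-lub {p = p} {q} p⊆r q⊆r x∈p∪q = [ p⊆r , q⊆r ] (x∈p∪q⁻ p q x∈p∪q)

module Properties (F : OrderedField) where
  open OF F
  open IsCommutativeRing isCommutativeRing
    using (+-comm; *-comm; *-assoc; +-identityˡ; +-identityʳ; *-identityˡ; *-identityʳ; zeroˡ; zeroʳ; distribˡ; distribʳ; -‿inverseʳ)
  open IsTotalOrder isTotalOrder using (reflexive; antisym; total) renaming (trans to ≤-trans)

  commutativeRing : CommutativeRing _ _
  commutativeRing = record { isCommutativeRing = isCommutativeRing }

  open import Tactic.RingSolver.NonReflective (fromCommutativeRing commutativeRing (λ _ → nothing))
    using (solve; _⊜_; _⊕_; _⊗_)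
  open import Algebra.Properties.AbelianGroup (CommutativeRing.+-abelianGroup commutativeRing)
    using (xyx⁻¹≈y; ⁻¹-involutive)
  open import Algebra.Properties.Group (CommutativeRing.+-group commutativeRing)
    using (//-rightDividesˡ)
  open import Algebra.Properties.Ring (CommutativeRing.ring commutativeRing) using (-1*x≈-x)

  poset : Poset _ _ _
  poset = record { isPartialOrder = IsTotalOrder.isPartialOrder isTotalOrder }

  open import Relation.Binary.Reasoning.PartialOrder poset public

  ≤-refl : ∀ {x} → x ≤ x
  ≤-refl = reflexive refl

  ≰⇒≥ : ∀ {x y} → ¬ x ≤ y → y ≤ x
  ≰⇒≥ {x} {y} x≰y = [ ⊥-elim ∘ x≰y , id ] (total x y)

  +-monoʳ-≤ : ∀ {x y} z → x ≤ y → z + x ≤ z + y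
  +-monoʳ-≤ {x} {y} z x≤y = subst₂ _≤_ (+-comm x z) (+-comm y z) (+-monoˡ-≤ z x≤y)

  +-mono-≤ : ∀ {x y u v} → x ≤ y → u ≤ v → x + u ≤ y + v
  +-mono-≤ {y = y} {u} x≤y u≤v = ≤-trans (+-monoˡ-≤ u x≤y) (+-monoʳ-≤ y u≤v)

  +-cancelˡ-≤ : ∀ x {y z} → x + y ≤ x + z → y ≤ z
  +-cancelˡ-≤ x {y} {z} = subst₂ _≤_ (xyx⁻¹≈y x y) (xyx⁻¹≈y x z) ∘ +-monoˡ-≤ (- x)

  x≤y⇒0≤y-x : ∀ {x y} → x ≤ y → 0# ≤ y - x
  x≤y⇒0≤y-x {x} = subst₂ _≤_ (-‿inverseʳ x) refl ∘ +-monoˡ-≤ (- x)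

  x≤x+nonneg : ∀ {x y} → 0# ≤ y → x ≤ x + y
  x≤x+nonneg {x} 0≤y = subst₂ _≤_ (+-identityʳ x) refl (+-monoʳ-≤ x 0≤y)

  x≤nonneg+x : ∀ {x y} → 0# ≤ y → x ≤ y + x
  x≤nonneg+x {x} {y} 0≤y = subst₂ _≤_ refl (+-comm x y) (x≤x+nonneg 0≤y)

  +-nonneg : ∀ {x y} → 0# ≤ x → 0# ≤ y → 0# ≤ x + y
  +-nonneg 0≤x 0≤y = ≤-trans 0≤x (x≤x+nonneg 0≤y)

  *-monoˡ-≤ : ∀ {x y} z → 0# ≤ z → x ≤ y → z * x ≤ z * y
  *-monoˡ-≤ {x} {y} z 0≤z x≤y = begin
    z * x                ≡⟨ sym (+-identityˡ (z * x)) ⟩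
    0# + z * x           ≤⟨ +-monoˡ-≤ (z * x) (*-nonneg 0≤z (x≤y⇒0≤y-x x≤y)) ⟩
    z * (y - x) + z * x  ≡⟨ sym (distribˡ z (y - x) x) ⟩
    z * (y - x + x)      ≡⟨ cong (z *_) (//-rightDividesˡ x y) ⟩
    z * y                ∎

  *-monoʳ-≤ : ∀ {x y} z → 0# ≤ z → x ≤ y → x * z ≤ y * z
  *-monoʳ-≤ {x} {y} z 0≤z x≤y = subst₂ _≤_ (*-comm z x) (*-comm z y) (*-monoˡ-≤ z 0≤z x≤y)

  0≤1 : 0# ≤ 1#
  0≤1 with total 0# 1#
  ... | inj₁ 0≤1 = 0≤1
  ... | inj₂ 1≤0 = subst₂ _≤_ refl -1*-1≡1 (*-nonneg 0≤-1 0≤-1)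
    where
    0≤-1 : 0# ≤ - 1#
    0≤-1 = subst₂ _≤_ (-‿inverseʳ 1#) (+-identityˡ (- 1#)) (+-monoˡ-≤ (- 1#) 1≤0)
    -1*-1≡1 : - 1# * - 1# ≡ 1#
    -1*-1≡1 = trans (-1*x≈-x (- 1#)) (⁻¹-involutive 1#)

  1≤x⇒x≢0 : ∀ {x} → 1# ≤ x → x ≢ 0#
  1≤x⇒x≢0 1≤x refl = 0≢1 (antisym 0≤1 1≤x)

  sumFin-mono-≤ : ∀ m {v w : Fin m → Carrier} → (∀ i → v i ≤ w i) → sumFin m v ≤ sumFin m w
  sumFin-mono-≤ ℕ.zero    v≤w = ≤-refl
  sumFin-mono-≤ (ℕ.suc m) v≤w = +-mono-≤ (v≤w zero) (sumFin-mono-≤ m (v≤w ∘ suc))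

  sumFin-*ˡ : ∀ m c (v : Fin m → Carrier) → sumFin m (λ i → c * v i) ≡ c * sumFin m v
  sumFin-*ˡ ℕ.zero    c v = sym (zeroʳ c)
  sumFin-*ˡ (ℕ.suc m) c v =
    trans (cong (c * v zero +_) (sumFin-*ˡ m c (v ∘ suc))) (sym (distribˡ c _ _))

  sumFin-nonneg : ∀ m {v : Fin m → Carrier} → (∀ i → 0# ≤ v i) → 0# ≤ sumFin m v
  sumFin-nonneg ℕ.zero    0≤v = ≤-refl
  sumFin-nonneg (ℕ.suc m) 0≤v = +-nonneg (0≤v zero) (sumFin-nonneg m (0≤v ∘ suc))

  ≤-sumFin : ∀ m {v : Fin m → Carrier} → (∀ i → 0# ≤ v i) → ∀ k → v k ≤ sumFin m v
  ≤-sumFin (ℕ.suc m) 0≤v zero    = x≤x+nonneg (sumFin-nonneg m (0≤v ∘ suc))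
  ≤-sumFin (ℕ.suc m) {v} 0≤v (suc k) = begin
    v (suc k)                    ≤⟨ ≤-sumFin m (0≤v ∘ suc) k ⟩
    sumFin m (v ∘ suc)           ≡⟨ sym (+-identityˡ _) ⟩
    0# + sumFin m (v ∘ suc)      ≤⟨ +-monoˡ-≤ _ (0≤v zero) ⟩
    sumFin (ℕ.suc m) v           ∎

  sumFin-≤-fromℕ* : ∀ m {v : Fin m → Carrier} {c} → (∀ i → v i ≤ c) → sumFin m v ≤ fromℕ m * c
  sumFin-≤-fromℕ* ℕ.zero    {c = c} v≤c = subst₂ _≤_ refl (sym (zeroˡ c)) ≤-refl
  sumFin-≤-fromℕ* (ℕ.suc m) {v} {c} v≤c = begin
    v zero + sumFin m (v ∘ suc)  ≤⟨ +-mono-≤ (v≤c zero) (sumFin-≤-fromℕ* m (v≤c ∘ suc)) ⟩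
    c + fromℕ m * c              ≡⟨ cong (_+ fromℕ m * c) (sym (*-identityˡ c)) ⟩
    1# * c + fromℕ m * c         ≡⟨ sym (distribʳ c 1# (fromℕ m)) ⟩
    (1# + fromℕ m) * c           ∎

  fromℕ-nonneg : ∀ k → 0# ≤ fromℕ k
  fromℕ-nonneg ℕ.zero    = ≤-refl
  fromℕ-nonneg (ℕ.suc k) = +-nonneg 0≤1 (fromℕ-nonneg k)

  fromℕ-nonZero : ∀ k .{{_ : NonZero k}} → fromℕ k ≢ 0#
  fromℕ-nonZero (ℕ.suc k) = 1≤x⇒x≢0 (x≤x+nonneg (fromℕ-nonneg k))

  fromℕ*fromℕ⁻¹ : ∀ k .{{_ : NonZero k}} → fromℕ k * fromℕ k ⁻¹ ≡ 1#
  fromℕ*fromℕ⁻¹ k = ⁻¹-inverse (fromℕ k) (fromℕ-nonZero k)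

  fromℕ⁻¹-nonneg : ∀ k .{{_ : NonZero k}} → 0# ≤ fromℕ k ⁻¹
  fromℕ⁻¹-nonneg k with total 0# (fromℕ k ⁻¹)
  ... | inj₁ 0≤k⁻¹ = 0≤k⁻¹
  ... | inj₂ k⁻¹≤0 = ⊥-elim (0≢1 (antisym 0≤1 1≤0))
    where
    1≤0 : 1# ≤ 0#
    1≤0 = subst₂ _≤_ (fromℕ*fromℕ⁻¹ k) (zeroʳ (fromℕ k)) (*-monoˡ-≤ _ (fromℕ-nonneg k) k⁻¹≤0)

  fromℕ⁻¹≤maximum : ∀ m .{{_ : NonZero m}} (v : Fin m → Carrier) k →
                    (∀ i → v i ≤ v k) → 1# ≤ sumFin m v → fromℕ m ⁻¹ ≤ v k
  fromℕ⁻¹≤maximum m v k v≤vk 1≤Σv = begin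
    fromℕ m ⁻¹                        ≡⟨ sym (*-identityʳ _) ⟩
    fromℕ m ⁻¹ * 1#                   ≤⟨ *-monoˡ-≤ _ (fromℕ⁻¹-nonneg m) (≤-trans 1≤Σv (sumFin-≤-fromℕ* m v≤vk)) ⟩
    fromℕ m ⁻¹ * (fromℕ m * v k)      ≡⟨ sym (*-assoc _ _ _) ⟩
    (fromℕ m ⁻¹ * fromℕ m) * v k      ≡⟨ cong (_* v k) (trans (*-comm _ _) (fromℕ*fromℕ⁻¹ m)) ⟩
    1# * v k                          ≡⟨ *-identityˡ (v k) ⟩
    v k                               ∎

  x≤max : ∀ x y → x ≤ max x y
  x≤max x y with x ≤? y
  ... | yes x≤y = x≤y
  ... | no  _   = ≤-refl

  y≤max : ∀ x y → y ≤ max x y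
  y≤max x y with x ≤? y
  ... | yes _   = ≤-refl
  ... | no  x≰y = ≰⇒≥ x≰y

  max-lub : ∀ {x y c} → x ≤ c → y ≤ c → max x y ≤ c
  max-lub {x} {y} x≤c y≤c with x ≤? y
  ... | yes _ = y≤c
  ... | no  _ = x≤c

  ≤-maxFin : ∀ m .{{_ : NonZero m}} (v : Fin m → Carrier) k → v k ≤ maxFin m v
  ≤-maxFin (ℕ.suc ℕ.zero)       v zero    = ≤-refl
  ≤-maxFin (ℕ.suc (ℕ.suc m))    v zero    = x≤max _ _
  ≤-maxFin (ℕ.suc (ℕ.suc m))    v (suc k) = ≤-trans (≤-maxFin (ℕ.suc m) (v ∘ suc) k) (y≤max _ _)

  maxFin-lub : ∀ m .{{_ : NonZero m}} {v : Fin m → Carrier} {c} → (∀ i → v i ≤ c) → maxFin m v ≤ c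
  maxFin-lub (ℕ.suc ℕ.zero)    v≤c = v≤c zero
  maxFin-lub (ℕ.suc (ℕ.suc m)) v≤c = max-lub (v≤c zero) (maxFin-lub (ℕ.suc m) (v≤c ∘ suc))

  maxFin-mono-≤ : ∀ m .{{_ : NonZero m}} {v w : Fin m → Carrier} → (∀ i → v i ≤ w i) → maxFin m v ≤ maxFin m w
  maxFin-mono-≤ m {w = w} v≤w = maxFin-lub m (λ i → ≤-trans (v≤w i) (≤-maxFin m w i))

  maxFin-*ˡ-≤ : ∀ m .{{_ : NonZero m}} {c} (v : Fin m → Carrier) → 0# ≤ c →
                maxFin m (λ i → c * v i) ≤ c * maxFin m v
  maxFin-*ˡ-≤ m v 0≤c = maxFin-lub m (λ i → *-monoˡ-≤ _ 0≤c (≤-maxFin m v i))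

  module _ (m : ℕ) .{{_ : NonZero m}} {lam : Carrier} (0≤lam : 0# ≤ lam) (lam≤1 : lam ≤ 1#) where

    objective-mono-≤ : ∀ {v w : Fin m → Carrier} → (∀ i → v i ≤ w i) → objective m lam v ≤ objective m lam w
    objective-mono-≤ v≤w =
      +-mono-≤ (*-monoˡ-≤ _ (x≤y⇒0≤y-x lam≤1) (maxFin-mono-≤ m v≤w))
               (*-monoˡ-≤ _ (*-nonneg 0≤lam (fromℕ⁻¹-nonneg m)) (sumFin-mono-≤ m v≤w))

    objective-*ˡ-≤ : ∀ {c} (v : Fin m → Carrier) → 0# ≤ c →
                     objective m lam (λ i → c * v i) ≤ c * objective m lam v
    objective-*ˡ-≤ {c} v 0≤c = begin
      μ * maxFin m (λ i → c * v i) + ν * sumFin m (λ i → c * v i)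
        ≤⟨ +-monoˡ-≤ _ (*-monoˡ-≤ μ (x≤y⇒0≤y-x lam≤1) (maxFin-*ˡ-≤ m v 0≤c)) ⟩
      μ * (c * maxFin m v) + ν * sumFin m (λ i → c * v i)
        ≡⟨ cong (λ s → μ * (c * maxFin m v) + ν * s) (sumFin-*ˡ m c v) ⟩
      μ * (c * maxFin m v) + ν * (c * sumFin m v)
        ≡⟨ solve 5 (λ μ ν c M S → (μ ⊗ (c ⊗ M) ⊕ ν ⊗ (c ⊗ S)) ⊜ (c ⊗ (μ ⊗ M ⊕ ν ⊗ S)))
                   refl μ ν c (maxFin m v) (sumFin m v) ⟩
      c * objective m lam v ∎
      where
      μ ν : Carrier
      μ = 1# - lam
      ν = lam * fromℕ m ⁻¹

  Descending : ∀ {n} → (Fin n → Carrier) → List (Fin n) → Set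
  Descending x = AllPairs (λ j k → x k ≤ x j)

  module _ {n} (x : Fin n → Carrier) where

    insertDesc-all : ∀ {P : Fin n → Set} {j} L → P j → All P L → All P (insertDesc x j L)
    insertDesc-all         []       pj []         = pj ∷ []
    insertDesc-all {j = j} (k ∷ ks) pj (pk ∷ pks) with x j ≤? x k
    ... | yes _ = pk ∷ insertDesc-all ks pj pks
    ... | no  _ = pj ∷ pk ∷ pks

    insertDesc-descending : ∀ j L → Descending x L → Descending x (insertDesc x j L)
    insertDesc-descending j []       []           = [] ∷ []
    insertDesc-descending j (k ∷ ks) (k≥ks ∷ ks↓) with x j ≤? x k
    ... | yes j≤k = insertDesc-all ks j≤k k≥ks ∷ insertDesc-descending j ks ks↓
    ... | no  j≰k = (≰⇒≥ j≰k ∷ All.map (λ q → ≤-trans q (≰⇒≥ j≰k)) k≥ks) ∷ k≥ks ∷ ks↓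

    ∈-insertDesc⁺ˡ : ∀ j L → j ∈ₗ insertDesc x j L
    ∈-insertDesc⁺ˡ j []       = here refl
    ∈-insertDesc⁺ˡ j (k ∷ ks) with x j ≤? x k
    ... | yes _ = there (∈-insertDesc⁺ˡ j ks)
    ... | no  _ = here refl

    ∈-insertDesc⁺ʳ : ∀ {a} j L → a ∈ₗ L → a ∈ₗ insertDesc x j L
    ∈-insertDesc⁺ʳ j (k ∷ ks) a∈L with x j ≤? x k | a∈L
    ... | yes _ | here a≡k  = here a≡k
    ... | yes _ | there a∈ks = there (∈-insertDesc⁺ʳ j ks a∈ks)
    ... | no  _ | _          = there a∈L

    sortDesc-descending : Descending x (sortDesc x)
    sortDesc-descending = go (allFin n)
      where
      go : ∀ L → Descending x (foldr (insertDesc x) [] L)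
      go []      = []
      go (j ∷ L) = insertDesc-descending j _ (go L)

    ∈-sortDesc : ∀ a → a ∈ₗ sortDesc x
    ∈-sortDesc a = go (allFin n) (∈-allFin a)
      where
      go : ∀ L → a ∈ₗ L → a ∈ₗ foldr (insertDesc x) [] L
      go (j ∷ L) (here refl)  = ∈-insertDesc⁺ˡ j (foldr (insertDesc x) [] L)
      go (j ∷ L) (there a∈L) = ∈-insertDesc⁺ʳ j (foldr (insertDesc x) [] L) (go L a∈L)

  module _ {n} {f : SetFun n} (f-mono : Monotone f) where

    marginal-nonneg : ∀ S j → 0# ≤ f (S ∪ ⁅ j ⁆) - f S
    marginal-nonneg S j = x≤y⇒0≤y-x (f-mono _ _ (p⊆p∪q ⁅ j ⁆))

    lovászAux-nonneg : ∀ {x} → (∀ j → 0# ≤ x j) → ∀ S L → 0# ≤ lovászAux f x S L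
    lovászAux-nonneg 0≤x S []      = ≤-refl
    lovászAux-nonneg 0≤x S (j ∷ L) =
      +-nonneg (*-nonneg (0≤x j) (marginal-nonneg S j)) (lovászAux-nonneg 0≤x (S ∪ ⁅ j ⁆) L)

    module _ {x : Fin n → Carrier} (0≤x : ∀ j → 0# ≤ x j) {c} (0≤c : 0# ≤ c) {A : Subset n} where

      private
        lowerBound-A⊆S : ∀ {S} L → A ⊆ S → c * f (S ∪ A) ≤ lovászAux f x S L + c * f S
        lowerBound-A⊆S {S} L A⊆S = begin
          c * f (S ∪ A)                  ≤⟨ *-monoˡ-≤ c 0≤c (f-mono _ _ (∪-lub id A⊆S)) ⟩
          c * f S                        ≤⟨ x≤nonneg+x (lovászAux-nonneg 0≤x S L) ⟩
          lovászAux f x S L + c * f S    ∎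

      -- The elements of A not yet in S all come in L with x ≥ c; since L is descending, they
      -- form an initial segment of L, on which each marginal gain is weighted by at least c.
      lovászAux-lowerBound : ∀ S L → Descending x L → (∀ {a} → a ∈ A → a ∈ S ⊎ (a ∈ₗ L × c ≤ x a)) →
                             c * f (S ∪ A) ≤ lovászAux f x S L + c * f S
      lovászAux-lowerBound S [] [] A⊆ = lowerBound-A⊆S [] (λ a∈A → [ id , (λ { (() , _) }) ] (A⊆ a∈A))
      lovászAux-lowerBound S (j ∷ L) (j≥L ∷ L↓) A⊆ with c ≤? x j
      ... | no c≰xj = lowerBound-A⊆S (j ∷ L) A⊆S
        where
        A⊆S : A ⊆ S
        A⊆S a∈A with A⊆ a∈A
        ... | inj₁ a∈S                = a∈S
        ... | inj₂ (here refl  , c≤xj) = ⊥-elim (c≰xj c≤xj)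
        ... | inj₂ (there a∈L , c≤xa) = ⊥-elim (c≰xj (≤-trans c≤xa (All.lookup j≥L a∈L)))
      ... | yes c≤xj = begin
        c * f (S ∪ A)                          ≤⟨ *-monoˡ-≤ c 0≤c (f-mono _ _ S∪A⊆S'∪A) ⟩
        c * f (S' ∪ A)                         ≤⟨ lovászAux-lowerBound S' L L↓ A⊆S'∪L ⟩
        r + c * f S'                           ≡⟨ cong (r +_) c*fS'≡ ⟩
        r + (c * Δ + c * f S)                  ≤⟨ +-monoʳ-≤ r (+-monoˡ-≤ _ (*-monoʳ-≤ Δ (marginal-nonneg S j) c≤xj)) ⟩
        r + (x j * Δ + c * f S)                ≡⟨ solve 3 (λ r u v → (r ⊕ (u ⊕ v)) ⊜ ((u ⊕ r) ⊕ v)) refl r _ _ ⟩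
        lovászAux f x S (j ∷ L) + c * f S      ∎
        where
        S' : Subset n
        S' = S ∪ ⁅ j ⁆
        r Δ : Carrier
        r  = lovászAux f x S' L
        Δ  = f S' - f S
        S∪A⊆S'∪A : S ∪ A ⊆ S' ∪ A
        S∪A⊆S'∪A = ∪-lub (p⊆p∪q A ∘ p⊆p∪q ⁅ j ⁆) (q⊆p∪q S' A)
        A⊆S'∪L : ∀ {a} → a ∈ A → a ∈ S' ⊎ (a ∈ₗ L × c ≤ x a)
        A⊆S'∪L a∈A with A⊆ a∈A
        ... | inj₁ a∈S              = inj₁ (p⊆p∪q ⁅ j ⁆ a∈S)
        ... | inj₂ (here refl , _)  = inj₁ (q⊆p∪q S ⁅ j ⁆ (x∈⁅x⁆ j))
        ... | inj₂ (there a∈L , c≤xa) = inj₂ (a∈L , c≤xa)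
        c*fS'≡ : c * f S' ≡ c * Δ + c * f S
        c*fS'≡ = trans (cong (c *_) (sym (//-rightDividesˡ (f S) (f S')))) (distribˡ c Δ (f S))

      lovász-lowerBound : Normalized f → (∀ {a} → a ∈ A → c ≤ x a) → c * f A ≤ lovász f x
      lovász-lowerBound f∅≡0 c≤x = begin
        c * f A                             ≡⟨ cong (λ B → c * f B) (sym (∪-identityˡ A)) ⟩
        c * f (∅ ∪ A)                       ≤⟨ lovászAux-lowerBound ∅ (sortDesc x) (sortDesc-descending x)
                                                 (λ {a} a∈A → inj₂ (∈-sortDesc x a , c≤x a∈A)) ⟩
        lovász f x + c * f ∅                ≡⟨ cong (λ y → lovász f x + c * y) f∅≡0 ⟩
        lovász f x + c * 0#                 ≡⟨ trans (cong (lovász f x +_) (zeroʳ c)) (+-identityʳ _) ⟩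
        lovász f x                          ∎

  diminishing-returns : ∀ {n} {f : SetFun n} → Monotone f → Submodular f →
                        ∀ {S T} A → S ⊆ T → f (T ∪ A) + f S ≤ f T + f (S ∪ A)
  diminishing-returns {f = f} f-mono f-sub {S} {T} A S⊆T = begin
    f (T ∪ A) + f S                      ≤⟨ +-mono-≤ (f-mono _ _ T∪A⊆T∪S∪A) (f-mono _ _ S⊆T∩S∪A) ⟩
    f (T ∪ (S ∪ A)) + f (T ∩ (S ∪ A))    ≤⟨ f-sub T (S ∪ A) ⟩
    f T + f (S ∪ A)                      ∎
    where
    T∪A⊆T∪S∪A : T ∪ A ⊆ T ∪ (S ∪ A)
    T∪A⊆T∪S∪A = ∪-lub (p⊆p∪q (S ∪ A)) (q⊆p∪q T (S ∪ A) ∘ q⊆p∪q S A)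
    S⊆T∩S∪A : S ⊆ T ∩ (S ∪ A)
    S⊆T∩S∪A s = x∈p∩q⁺ (S⊆T s , p⊆p∪q A s)

  indicator : ∀ {n} → Subset n → Fin n → Carrier
  indicator A j = if does (j ∈? A) then 1# else 0#

  module _ {n} {A : Subset n} where

    indicator-∈ : ∀ {j} → j ∈ A → indicator A j ≡ 1#
    indicator-∈ {j} j∈A = cong (if_then 1# else 0#) (dec-true (j ∈? A) j∈A)

    indicator-cases : ∀ j → (j ∈ A × indicator A j ≡ 1#) ⊎ indicator A j ≡ 0#
    indicator-cases j with j ∈? A
    ... | yes j∈A = inj₁ (j∈A , refl)
    ... | no  _   = inj₂ refl

    indicator-unit : ∀ j → 0# ≤ indicator A j × indicator A j ≤ 1#
    indicator-unit j with indicator-cases j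
    ... | inj₁ (_ , χ≡1) = subst₂ _≤_ refl (sym χ≡1) 0≤1 , subst₂ _≤_ (sym χ≡1) refl ≤-refl
    ... | inj₂ χ≡0       = subst₂ _≤_ refl (sym χ≡0) ≤-refl , subst₂ _≤_ (sym χ≡0) refl 0≤1

    module _ {f : SetFun n} (f-mono : Monotone f) (f-sub : Submodular f) where

      -- Marginal gains weighted by 1 stay inside A; those weighted by 0 vanish, and
      -- diminishing returns lets the later gains be charged to S instead of S ∪ ⁅ j ⁆.
      lovászAux-indicator-≤ : ∀ S L → lovászAux f (indicator A) S L + f S ≤ f (S ∪ A)
      lovászAux-indicator-≤ S [] = subst₂ _≤_ (sym (+-identityˡ (f S))) refl (f-mono _ _ (p⊆p∪q A))
      lovászAux-indicator-≤ S (j ∷ L) with indicator-cases j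
      ... | inj₁ (j∈A , χ≡1) = begin
        (indicator A j * Δ + r) + f S      ≡⟨ cong (λ y → (y * Δ + r) + f S) χ≡1 ⟩
        (1# * Δ + r) + f S                 ≡⟨ cong (λ y → (y + r) + f S) (*-identityˡ Δ) ⟩
        (Δ + r) + f S                      ≡⟨ solve 3 (λ d r s → ((d ⊕ r) ⊕ s) ⊜ (r ⊕ (d ⊕ s))) refl Δ r (f S) ⟩
        r + (Δ + f S)                      ≡⟨ cong (r +_) (//-rightDividesˡ (f S) (f S')) ⟩
        r + f S'                           ≤⟨ lovászAux-indicator-≤ S' L ⟩
        f (S' ∪ A)                         ≤⟨ f-mono _ _ (∪-lub (∪-lub (p⊆p∪q A) j⊆S∪A) (q⊆p∪q S A)) ⟩
        f (S ∪ A)                          ∎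
        where
        S' : Subset n
        S' = S ∪ ⁅ j ⁆
        r Δ : Carrier
        r  = lovászAux f (indicator A) S' L
        Δ  = f S' - f S
        j⊆S∪A : ⁅ j ⁆ ⊆ S ∪ A
        j⊆S∪A k∈⁅j⁆ rewrite x∈⁅y⁆⇒x≡y j k∈⁅j⁆ = q⊆p∪q S A j∈A
      ... | inj₂ χ≡0 = +-cancelˡ-≤ (f S') (begin
        f S' + ((indicator A j * Δ + r) + f S)   ≡⟨ cong (λ y → f S' + ((y * Δ + r) + f S)) χ≡0 ⟩
        f S' + ((0# * Δ + r) + f S)              ≡⟨ cong (λ y → f S' + (y + f S)) 0Δ+r≡r ⟩
        f S' + (r + f S)                         ≡⟨ solve 3 (λ a r s → (a ⊕ (r ⊕ s)) ⊜ ((r ⊕ a) ⊕ s)) refl (f S') r (f S) ⟩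
        (r + f S') + f S                         ≤⟨ +-monoˡ-≤ (f S) (lovászAux-indicator-≤ S' L) ⟩
        f (S' ∪ A) + f S                         ≤⟨ diminishing-returns f-mono f-sub A (p⊆p∪q ⁅ j ⁆) ⟩
        f S' + f (S ∪ A)                         ∎)
        where
        S' : Subset n
        S' = S ∪ ⁅ j ⁆
        r Δ : Carrier
        r  = lovászAux f (indicator A) S' L
        Δ  = f S' - f S
        0Δ+r≡r : 0# * Δ + r ≡ r
        0Δ+r≡r = trans (cong (_+ r) (zeroˡ Δ)) (+-identityˡ r)

      lovász-indicator-≤ : Normalized f → lovász f (indicator A) ≤ f A
      lovász-indicator-≤ f∅≡0 = begin
        lovász f (indicator A)                         ≡⟨ sym (+-identityʳ _) ⟩
        lovász f (indicator A) + 0#                    ≡⟨ cong (lovász f (indicator A) +_) (sym f∅≡0) ⟩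
        lovász f (indicator A) + f ∅                   ≤⟨ lovászAux-indicator-≤ ∅ (sortDesc (indicator A)) ⟩
        f (∅ ∪ A)                                      ≡⟨ cong f (∪-identityˡ A) ⟩
        f A                                            ∎

  module _ {n m : ℕ} (π : Partition n m) where

    ∈-block⁺ : ∀ {i j} → π j ≡ i → j ∈ block π i
    ∈-block⁺ {i} {j} πj≡i =
      lookup⇒[]= j (block π i) (trans (lookup∘tabulate _ j) (dec-true (π j ≟ i) πj≡i))

    ∈-block⁻ : ∀ {i j} → j ∈ block π i → π j ≡ i
    ∈-block⁻ {i} {j} j∈πᵢ with π j ≟ i | trans (sym (lookup∘tabulate _ j)) ([]=⇒lookup j∈πᵢ)
    ... | yes πj≡i | _ = πj≡i
    ... | no _     | ()

  indicator-feasible : ∀ {n m} (π : Partition n m) → Feasible (λ i → indicator (block π i))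
  indicator-feasible {m = m} π = (λ i → indicator-unit) , covers
    where
    covers : ∀ j → 1# ≤ sumFin m (λ i → indicator (block π i) j)
    covers j = begin
      1#                                       ≡⟨ sym (indicator-∈ (∈-block⁺ π {j = j} refl)) ⟩
      indicator (block π (π j)) j              ≤⟨ ≤-sumFin m (λ i → proj₁ (indicator-unit j)) (π j) ⟩
      sumFin m (λ i → indicator (block π i) j) ∎

  fromℕ⁻¹*y≤z⇒y≤fromℕ*z : ∀ m .{{_ : NonZero m}} {y z} → fromℕ m ⁻¹ * y ≤ z → y ≤ fromℕ m * z
  fromℕ⁻¹*y≤z⇒y≤fromℕ*z m {y} {z} k⁻¹y≤z = begin
    y                              ≡⟨ sym (*-identityˡ y) ⟩
    1# * y                         ≡⟨ cong (_* y) (sym (fromℕ*fromℕ⁻¹ m)) ⟩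
    (fromℕ m * fromℕ m ⁻¹) * y     ≡⟨ *-assoc _ _ _ ⟩
    fromℕ m * (fromℕ m ⁻¹ * y)     ≤⟨ *-monoˡ-≤ _ (fromℕ-nonneg m) k⁻¹y≤z ⟩
    fromℕ m * z                    ∎

theorem12 : (F : OrderedField) → let open OF F in
    (n m : ℕ) → .{{_ : NonZero m}} →
    (lam : Carrier) → 0# ≤ lam → lam ≤ 1# →
    (f : Fin m → SetFun n) →
    (∀ i → Normalized (f i) × Monotone (f i) × Submodular (f i)) →
    (xs : Fin m → Fin n → Carrier) → Optimal m f lam xs →
    (π̂ : Partition n m) → (∀ j i → xs i j ≤ xs (π̂ j) j) →
    (π : Partition n m) →
    objective m lam (λ i → f i (block π̂ i))
      ≤ fromℕ m * objective m lam (λ i → f i (block π i))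
theorem12 F n m lam 0≤lam lam≤1 f f-props xs ((xs-unit , xs-covers) , xs-optimal) π̂ π̂-argmax π = begin
  objective m lam (λ i → f i (block π̂ i))
    ≤⟨ objective-mono-≤ m 0≤lam lam≤1 rounding-loss ⟩
  objective m lam (λ i → fromℕ m * lovász (f i) (xs i))
    ≤⟨ objective-*ˡ-≤ m 0≤lam lam≤1 _ (fromℕ-nonneg m) ⟩
  fromℕ m * objective m lam (λ i → lovász (f i) (xs i))
    ≤⟨ *-monoˡ-≤ _ (fromℕ-nonneg m) (xs-optimal _ (indicator-feasible π)) ⟩
  fromℕ m * objective m lam (λ i → lovász (f i) (indicator (block π i)))
    ≤⟨ *-monoˡ-≤ _ (fromℕ-nonneg m) (objective-mono-≤ m 0≤lam lam≤1 λ i →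
         lovász-indicator-≤ (monotone i) (submodular i) (normalized i)) ⟩
  fromℕ m * objective m lam (λ i → f i (block π i))
    ∎
  where
  open OF F
  open Properties F
  normalized : ∀ i → Normalized (f i)
  normalized = proj₁ ∘ f-props
  monotone : ∀ i → Monotone (f i)
  monotone = proj₁ ∘ proj₂ ∘ f-props
  submodular : ∀ i → Submodular (f i)
  submodular = proj₂ ∘ proj₂ ∘ f-props

  rounding-loss : ∀ i → f i (block π̂ i) ≤ fromℕ m * lovász (f i) (xs i)
  rounding-loss i = fromℕ⁻¹*y≤z⇒y≤fromℕ*z m
    (lovász-lowerBound (monotone i) (proj₁ ∘ xs-unit i) (fromℕ⁻¹-nonneg m) (normalized i) large)
    where
    large : ∀ {a} → a ∈ block π̂ i → fromℕ m ⁻¹ ≤ xs i a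
    large {a} a∈Âᵢ = subst (λ k → fromℕ m ⁻¹ ≤ xs k a) (∈-block⁻ π̂ a∈Âᵢ)
      (fromℕ⁻¹≤maximum m (λ k → xs k a) (π̂ a) (π̂-argmax a) (xs-covers a))
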